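{- Let $r\geq 3$ and let $g'$ be an even integer. Assume there is an $r$-regular graph of girth $g'$ which is Hamiltonian and has exactly $n_0(r,g')=2\sum_{i=0}^{g'/2-1}(r-1)^i$ vertices. Then there exists an integer $g$ with $g'+1\leq g\leq \frac{3}{2}g'-1$ such that $n(2,r-2,g)\leq n_0(r,g')$.
   Context: A weighted graph (wgraph) is a pair $G=(L,H)$ of simple finite graphs with $V(L)=V(H)$ and $E(L)\cap E(H)=\varnothing$; edges of $L$ are light (weight 1) and edges of $H$ are heavy (weight 2). A wcycle is a cycle (of length at least 3) in the graph with edge set $E(L)\cup E(H)$; its weight is the sum of the weights of its edges. The girth of $G$ is the minimum weight of a wcycle. $G$ is $(a,b)$-regular if $L$ is $a$-regular and $H$ is $b$-regular. An $(a,b,g)$-wgraph is an $(a,b)$-regular wgraph of girth $g$; $n(a,b,g)$ is the minimum order of an $(a,b,g)$-wgraph ($\infty$ if none exists). -}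

module Defs where

open import Data.Nat using (ℕ; zero; suc; _+_; _*_; _∸_; _^_; _≤_)
open import Data.Nat.DivMod using (_/_)
open import Data.Bool using (Bool; true; false; if_then_else_)
open import Data.Fin using (Fin)
open import Data.List using (List; []; _∷_; _++_; [_]; length; map; upTo; allFin)
open import Data.Nat.ListAction using (sum)
open import Data.List.Relation.Unary.Unique.Propositional using (Unique)
open import Data.List.Relation.Unary.Linked using (Linked)
open import Data.Product using (Σ; _×_; ∃)
open import Data.Sum using (_⊎_)
open import Relation.Binary.PropositionalEquality using (_≡_)
open import Relation.Nullary using (¬_)

record SimpleGraph (n : ℕ) : Set where
  field
    adj    : Fin n → Fin n → Bool
    sym    : ∀ u v → adj u v ≡ adj v u
    irrefl : ∀ v → adj v v ≡ false
open SimpleGraph public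

degree : ∀ {n} → (Fin n → Fin n → Bool) → Fin n → ℕ
degree {n} a v = sum (map (λ w → if a v w then 1 else 0) (allFin n))

Regular : ∀ {n} → ℕ → SimpleGraph n → Set
Regular r G = ∀ v → degree (adj G) v ≡ r

-- A cycle in the graph with edge relation E: a list of pairwise distinct
-- vertices v ∷ vs with at least 3 vertices, consecutive vertices adjacent,
-- and the last one adjacent to the first (closed walk v ∷ vs ++ [ v ]).
record Cycle {n : ℕ} (E : Fin n → Fin n → Set) : Set where
  field
    start    : Fin n
    rest     : List (Fin n)
    long     : 2 ≤ length rest
    distinct : Unique (start ∷ rest)
    closed   : Linked E (start ∷ rest ++ [ start ])
open Cycle public

cycleLength : ∀ {n} {E : Fin n → Fin n → Set} → Cycle E → ℕ
cycleLength c = suc (length (rest c))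

Edge : ∀ {n} → SimpleGraph n → Fin n → Fin n → Set
Edge G u v = adj G u v ≡ true

HasGirth : ∀ {n} → SimpleGraph n → ℕ → Set
HasGirth G g =
  (Σ (Cycle (Edge G)) λ c → cycleLength c ≡ g) ×
  (∀ (c : Cycle (Edge G)) → g ≤ cycleLength c)

Hamiltonian : ∀ {n} → SimpleGraph n → Set
Hamiltonian {n} G = Σ (Cycle (Edge G)) λ c → cycleLength c ≡ n

record WGraph (n : ℕ) : Set where
  field
    light    : SimpleGraph n
    heavy    : SimpleGraph n
    disjoint : ∀ u v → ¬ (adj light u v ≡ true × adj heavy u v ≡ true)
open WGraph public

WEdge : ∀ {n} → WGraph n → Fin n → Fin n → Set
WEdge W u v = adj (light W) u v ≡ true ⊎ adj (heavy W) u v ≡ true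

edgeWeight : ∀ {n} → WGraph n → Fin n → Fin n → ℕ
edgeWeight W u v = if adj (light W) u v then 1 else 2

walkWeight : ∀ {n} → WGraph n → List (Fin n) → ℕ
walkWeight W []           = 0
walkWeight W (x ∷ [])     = 0
walkWeight W (x ∷ y ∷ xs) = edgeWeight W x y + walkWeight W (y ∷ xs)

cycleWeight : ∀ {n} (W : WGraph n) → Cycle (WEdge W) → ℕ
cycleWeight W c = walkWeight W (start c ∷ rest c ++ [ start c ])

WRegular : ∀ {n} → ℕ → ℕ → WGraph n → Set
WRegular a b W = Regular a (light W) × Regular b (heavy W)

HasWGirth : ∀ {n} → WGraph n → ℕ → Set
HasWGirth W g =
  (Σ (Cycle (WEdge W)) λ c → cycleWeight W c ≡ g) ×
  (∀ (c : Cycle (WEdge W)) → g ≤ cycleWeight W c)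

IsABGWGraph : ∀ {n} → ℕ → ℕ → ℕ → WGraph n → Set
IsABGWGraph a b g W = WRegular a b W × HasWGirth W g

-- n(a,b,g) ≤ N  (n(a,b,g) is a minimum order, ∞ if no such wgraph exists)
nABG≤ : ℕ → ℕ → ℕ → ℕ → Set
nABG≤ a b g N = ∃ λ m → m ≤ N × Σ (WGraph m) (IsABGWGraph a b g)

n₀ : ℕ → ℕ → ℕ
n₀ r g′ = 2 * sum (map (λ i → (r ∸ 1) ^ i) (upTo (g′ / 2)))

{-# OPTIONS --safe #-}

-- Write g′ = 2D and q = r - 1, so that n₀ = 2 (1 + q + ⋯ + q ^ (D - 1)) is the Moore bound for
-- r-regular graphs of girth 2D, and let h₀ h₁ ⋯ be the Hamiltonian cycle H of G.  Declaring the
-- edges of H light and all other edges heavy gives a (2, r - 2)-regular wgraph on n₀ vertices.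
-- Its girth g satisfies:
--
-- g ≥ 2D + 1.  A wcycle of light edges never turns back along H, so it runs all the way round H
-- and has length n₀ > 2D; any other wcycle weighs more than its length, which is at least 2D.
--
-- g ≤ 3D - 1.  As G attains the Moore bound, every vertex is within distance D - 1 of h₀ on its
-- side of the edge h₀h₁, or of h₁ on the other side.  For h_{D+1} the latter is impossible: the
-- path h₁ ⋯ h_{D+1} of length D would close a cycle shorter than 2D.  So a path of length ℓ < D
-- from h₀ to h_{D+1} avoiding h₁, followed back along H, closes a cycle of length ℓ + D + 1.
-- Girth 2D forces ℓ = D - 1, and the cycle has D + 1 light edges, so its weight is at most
-- 2ℓ + D + 1 = 3D - 1.
--
-- Paths are handled as non-backtracking walks, using that two distinct such walks with the same
-- ends, or a closed one, contain a cycle no longer than they are.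

module Submission where

open import Defs hiding (sym)
open import Data.Bool using (Bool; true; false; not; _∧_; _∨_; if_then_else_)
open import Data.Bool.Properties using (∧-assoc; ∧-inverseˡ; ∧-zeroʳ; T-≡) renaming (_≟_ to _≟ᵇ_)
open import Data.Fin using (Fin; zero; suc; toℕ; fromℕ<) renaming (_≟_ to _≟ᶠ_)
open import Data.Fin.Properties using (injective⇒≤; toℕ<n; toℕ-fromℕ<) renaming (any? to any?ᶠ)
open import Data.List
  using (List; []; _∷_; _++_; [_]; length; map; filter; allFin; concatMap; lookup; upTo; applyUpTo)
open import Data.List.Properties using (∷-injectiveˡ; map-cong; length-++; length-++-sucʳ; length-++-≤ˡ)
open import Data.List.Membership.Propositional using (_∈_; _∉_; find)
open import Data.List.Membership.Propositional.Properties
  using (∈-lookup; ∈-∃++; ∈-filter⁻; ∈-concatMap⁻; ∈-allFin; ∈-++⁻)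
import Data.List.Membership.DecPropositional as DecMembership
open import Data.List.Relation.Unary.All as All using (All; []; _∷_)
open import Data.List.Relation.Unary.All.Properties using (¬Any⇒All¬; All¬⇒¬Any) renaming (++⁻ to All++⁻)
open import Data.List.Relation.Unary.AllPairs using ([]; _∷_)
open import Data.List.Relation.Unary.Any using (here; there; index)
open import Data.List.Relation.Unary.Any.Properties using (lookup-index)
open import Data.List.Relation.Unary.Linked as Linked using (Linked; []; [-]; _∷_; linked?)
open import Data.List.Relation.Unary.Unique.Propositional using (Unique)
open import Data.List.Relation.Unary.Unique.Propositional.Properties using (++⁺; filter⁺; allFin⁺)
open import Data.List.Relation.Unary.Unique.DecPropositional using (unique?)
open import Data.Nat using (ℕ; zero; suc; _+_; _*_; _∸_; _^_; _≤_; _<_; z≤n; s≤s; NonZero; >-nonZero; _≤?_; _≟_)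
open import Data.Nat.DivMod
  using (_%_; _/_; m*n/n≡m; %-distribˡ-+; %-remove-+ˡ; m≡m%n+[m/n]*n; m<n⇒m%n≡m; m%n<n; m%n%n≡m%n; n%n≡0)
open import Data.Nat.Divisibility using (_∣_; divides; ∣⇒≤; ∣-refl)
open import Data.Nat.GeneralisedArithmetic using (iterate)
open import Data.Nat.Induction using (<-rec)
open import Data.Nat.ListAction using (sum)
open import Data.Nat.Properties
  using ( ≤-refl; ≤-reflexive; ≤-trans; ≤-antisym; <⇒≤; <⇒≱; ≮⇒≥; <-irrefl; n≤1+n; m≤n⇒m≤1+n
        ; m≤n⇒m<n∨m≡n; m≤m+n; m≤n+m; m≤n*m; +-comm; +-suc; +-identityʳ; +-cancelʳ-≡; +-cancelʳ-≤
        ; +-mono-≤; +-monoˡ-≤; +-monoʳ-≤; +-mono-<; +-monoˡ-<; *-comm; *-zeroʳ; *-distribˡ-+; *-mono-≤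
        ; m+n∸n≡m; ∸-monoˡ-≤; anyUpTo?; module ≤-Reasoning )
open import Data.Nat.Tactic.RingSolver using (solve-∀)
open import Data.Product using (Σ; ∃; _×_; _,_; proj₁; proj₂)
open import Data.Sum using (_⊎_; inj₁; inj₂; swap)
open import Data.Unit using (⊤; tt)
open import Function.Base using (id; _∘_)
open import Function.Bundles using (Equivalence; mk⇔)
open import Relation.Binary.PropositionalEquality hiding ([_])
open import Relation.Nullary using (¬_; Dec; yes; no; does; contradiction; ¬?; _×-dec_; T?)
open import Relation.Nullary.Decidable using (map′; _⊎-dec_; dec-true; dec-false; does-⇔)
open import Relation.Unary using (Decidable)

lookup-injective : ∀ {A : Set} {xs : List A} → Unique xs →
                   ∀ {i j} → lookup xs i ≡ lookup xs j → i ≡ j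
lookup-injective {xs = _ ∷ _} (_    ∷ _) {zero}  {zero}  _  = refl
lookup-injective {xs = _ ∷ _} (x∉xs ∷ _) {zero}  {suc j} eq = contradiction eq (All.lookup x∉xs (∈-lookup j))
lookup-injective {xs = _ ∷ _} (x∉xs ∷ _) {suc i} {zero}  eq =
  contradiction (sym eq) (All.lookup x∉xs (∈-lookup i))
lookup-injective {xs = _ ∷ _} (_    ∷ u) {suc i} {suc j} eq = cong suc (lookup-injective u eq)

Unique⇒length≤ : ∀ {n} {xs : List (Fin n)} → Unique xs → length xs ≤ n
Unique⇒length≤ u = injective⇒≤ (lookup-injective u)

Unique∧length≡⇒∈ : ∀ {n} {xs : List (Fin n)} → Unique xs → length xs ≡ n → ∀ z → z ∈ xs
Unique∧length≡⇒∈ {xs = xs} u eq z with DecMembership._∈?_ _≟ᶠ_ z xs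
... | yes z∈xs = z∈xs
... | no  z∉xs = contradiction (Unique⇒length≤ (¬Any⇒All¬ xs z∉xs ∷ u)) (<-irrefl eq)

Unique-middle : ∀ {A : Set} {x : A} as {bs} → Unique (as ++ x ∷ bs) → Unique (x ∷ as)
Unique-middle [] _ = [] ∷ []
Unique-middle (a ∷ as) (a∉ ∷ u) with Unique-middle as u | All++⁻ as a∉
... | x∉as ∷ uas | a∉as , (a≢x ∷ _) = ((λ x≡a → a≢x (sym x≡a)) ∷ x∉as) ∷ (a∉as ∷ uas)

module _ {A : Set} {R : A → A → Set} where

  Linked-prefix : ∀ {x y} as {bs} → Linked R (x ∷ as ++ y ∷ bs) → Linked R (x ∷ as ++ [ y ])
  Linked-prefix []       (r ∷ _) = r ∷ [-]
  Linked-prefix (_ ∷ as) (r ∷ l) = r ∷ Linked-prefix as l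

length-snoc : ∀ {A : Set} (xs : List A) y → length (xs ++ [ y ]) ≡ suc (length xs)
length-snoc xs y = trans (length-++ xs) (+-comm (length xs) 1)

Unique-concatMap⁺ : ∀ {A B : Set} {f : A → List B} {xs} → Unique xs →
                    (∀ {x} → x ∈ xs → Unique (f x)) →
                    (∀ {x x′ z} → x ∈ xs → x′ ∈ xs → x ≢ x′ → z ∈ f x → z ∉ f x′) →
                    Unique (concatMap f xs)
Unique-concatMap⁺ {xs = []}         _          _        _          = []
Unique-concatMap⁺ {f = f} {x ∷ xs} (x∉xs ∷ u) unique-f disjoint-f =
  ++⁺ (unique-f (here refl))
      (Unique-concatMap⁺ u (λ x′∈ → unique-f (there x′∈))
                           (λ x₁∈ x₂∈ → disjoint-f (there x₁∈) (there x₂∈)))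
      λ (z∈fx , z∈rest) → let x′ , x′∈xs , z∈fx′ = find (∈-concatMap⁻ f {xs = xs} z∈rest)
                          in disjoint-f (here refl) (there x′∈xs) (All.lookup x∉xs x′∈xs) z∈fx z∈fx′

length-concatMap-const : ∀ {A B : Set} (f : A → List B) {c} xs →
                         (∀ {x} → x ∈ xs → length (f x) ≡ c) → length (concatMap f xs) ≡ length xs * c
length-concatMap-const f []       _     = refl
length-concatMap-const f (x ∷ xs) const = trans (length-++ (f x))
  (cong₂ _+_ (const (here refl)) (length-concatMap-const f xs (λ x′∈ → const (there x′∈))))

∃-list? : ∀ {n} {Q : List (Fin n) → Set} → (∀ xs → Dec (Q xs)) →
          ∀ k → Dec (∃ λ xs → length xs ≤ k × Q xs)
∃-list? Q? zero with Q? []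
... | yes q  = yes ([] , z≤n , q)
... | no  ¬q = no λ { ([] , _ , q) → ¬q q }
∃-list? Q? (suc k) with Q? [] | any?ᶠ (λ x → ∃-list? (λ xs → Q? (x ∷ xs)) k)
... | yes q  | _                        = yes ([] , z≤n , q)
... | no  _  | yes (x , xs , xs≤k , q) = yes (x ∷ xs , s≤s xs≤k , q)
... | no  ¬q | no  ¬r                   = no λ
  { ([] , _ , q)              → ¬q q
  ; (x ∷ xs , s≤s xs≤k , q) → ¬r (x , xs , xs≤k , q)
  }

module _ {P : ℕ → Set} (P? : Decidable P) where

  Least : Set
  Least = ∃ λ g → P g × ∀ {v} → P v → g ≤ v

  least : ∀ {w} → P w → Least
  least {w} = <-rec (λ w → P w → Least) step w
    where
    step : ∀ w → (∀ {v} → v < w → P v → Least) → P w → Least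
    step w smaller pw with anyUpTo? P? w
    ... | yes (v , v<w , pv) = smaller v<w pv
    ... | no  none           = w , pw , λ {v} pv → ≮⇒≥ (λ v<w → none (v , v<w , pv))

does-true⇒ : ∀ {P : Set} (P? : Dec P) → does P? ≡ true → P
does-true⇒ (yes p) _  = p
does-true⇒ (no _)  ()

count : ∀ {A : Set} → (A → Bool) → List A → ℕ
count b xs = sum (map (λ x → if b x then 1 else 0) xs)

module _ {A : Set} where

  count-cong : ∀ {b c : A → Bool} → (∀ x → b x ≡ c x) → ∀ xs → count b xs ≡ count c xs
  count-cong b≗c xs = cong sum (map-cong (λ x → cong (λ t → if t then 1 else 0) (b≗c x)) xs)

  count-∨ : ∀ {b c : A → Bool} → (∀ x → b x ∧ c x ≡ false) → ∀ xs →
            count (λ x → b x ∨ c x) xs ≡ count b xs + count c xs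
  count-∨ _ [] = refl
  count-∨ {b} {c} b∧c≡false (x ∷ xs) with b x | c x | b∧c≡false x
  ... | true  | false | _ = cong suc (count-∨ b∧c≡false xs)
  ... | false | true  | _ = trans (cong suc (count-∨ b∧c≡false xs)) (sym (+-suc _ _))
  ... | false | false | _ = count-∨ b∧c≡false xs

  count-∧-not : ∀ {b c : A → Bool} → (∀ x → c x ≡ true → b x ≡ true) → ∀ xs →
                count (λ x → b x ∧ not (c x)) xs + count c xs ≡ count b xs
  count-∧-not {b} {c} c⇒b xs = begin
    count (λ x → b x ∧ not (c x)) xs + count c xs ≡⟨ count-∨ (λ x → ∧-not-disjoint (b x) (c x)) xs ⟨
    count (λ x → (b x ∧ not (c x)) ∨ c x) xs      ≡⟨ count-cong (λ x → ∧-not-∨ (c⇒b x)) xs ⟩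
    count b xs                                    ∎
    where
    open ≡-Reasoning
    ∧-not-disjoint : ∀ b c → (b ∧ not c) ∧ c ≡ false
    ∧-not-disjoint b c = trans (∧-assoc b (not c) c) (trans (cong (b ∧_) (∧-inverseˡ c)) (∧-zeroʳ b))
    ∧-not-∨ : ∀ {b c} → (c ≡ true → b ≡ true) → (b ∧ not c) ∨ c ≡ b
    ∧-not-∨ {true}  {true}  _   = refl
    ∧-not-∨ {true}  {false} _   = refl
    ∧-not-∨ {false} {false} _   = refl
    ∧-not-∨ {false} {true}  c⇒b = sym (c⇒b refl)

  length-filter≡count : ∀ {P : A → Set} (P? : Decidable P) xs →
                        length (filter P? xs) ≡ count (λ x → does (P? x)) xs
  length-filter≡count P? [] = refl
  length-filter≡count P? (x ∷ xs) with does (P? x)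
  ... | true  = cong suc (length-filter≡count P? xs)
  ... | false = length-filter≡count P? xs

module _ {n : ℕ} where

  count-≟-∉ : ∀ {a : Fin n} {xs} → a ∉ xs → count (λ x → does (x ≟ᶠ a)) xs ≡ 0
  count-≟-∉ {xs = []}     _   = refl
  count-≟-∉ {a} {x ∷ xs} a∉ with x ≟ᶠ a
  ... | yes refl = contradiction (here refl) a∉
  ... | no  _    = count-≟-∉ (λ a∈ → a∉ (there a∈))

  count-≟ : ∀ {a : Fin n} {xs} → Unique xs → a ∈ xs → count (λ x → does (x ≟ᶠ a)) xs ≡ 1
  count-≟ {a} {x ∷ xs} (x∉xs ∷ u) a∈ with x ≟ᶠ a | a∈
  ... | yes refl | _          = cong suc (count-≟-∉ (All¬⇒¬Any x∉xs))
  ... | no  x≢a  | here a≡x   = contradiction (sym a≡x) x≢a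
  ... | no  _    | there a∈xs = count-≟ u a∈xs

module _ {A : Set} where

  iterate-comm : ∀ (f : A → A) x k → iterate f (f x) k ≡ f (iterate f x k)
  iterate-comm f x zero    = refl
  iterate-comm f x (suc k) = iterate-comm f (f x) k

  iterate-inverse : ∀ {f g : A → A} → (∀ x → f (g x) ≡ x) → ∀ k x → iterate f (iterate g x k) k ≡ x
  iterate-inverse         f∘g≡id zero    x = refl
  iterate-inverse {f} {g} f∘g≡id (suc k) x = begin
    iterate f (f (iterate g (g x) k)) k   ≡⟨ cong (λ y → iterate f (f y) k) (iterate-comm g x k) ⟩
    iterate f (f (g (iterate g x k))) k   ≡⟨ cong (λ y → iterate f y k) (f∘g≡id (iterate g x k)) ⟩
    iterate f (iterate g x k) k           ≡⟨ iterate-inverse f∘g≡id k x ⟩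
    x                                     ∎
    where open ≡-Reasoning

at : ∀ {A : Set} → A → List A → ℕ → A
at d []       _       = d
at d (x ∷ _)  zero    = x
at d (_ ∷ xs) (suc k) = at d xs k

module _ {A : Set} {d : A} where

  at-lookup : ∀ xs (i : Fin (length xs)) → at d xs (toℕ i) ≡ lookup xs i
  at-lookup (_ ∷ _)  zero    = refl
  at-lookup (_ ∷ xs) (suc i) = at-lookup xs i

  at-length : ∀ xs → at d xs (length xs) ≡ d
  at-length []       = refl
  at-length (_ ∷ xs) = at-length xs

  at-injective : ∀ {xs i j} → Unique xs → (i< : i < length xs) (j< : j < length xs) →
                 at d xs i ≡ at d xs j → i ≡ j
  at-injective {xs} u i< j< eq =
    trans (sym (toℕ-fromℕ< i<)) (trans (cong toℕ (lookup-injective u lookup-eq)) (toℕ-fromℕ< j<))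
    where
    at≡lookup : ∀ {k} (k< : k < length xs) → at d xs k ≡ lookup xs (fromℕ< k<)
    at≡lookup k< = trans (cong (at d xs) (sym (toℕ-fromℕ< k<))) (at-lookup xs (fromℕ< k<))
    lookup-eq : lookup xs (fromℕ< i<) ≡ lookup xs (fromℕ< j<)
    lookup-eq = trans (sym (at≡lookup i<)) (trans eq (at≡lookup j<))

  Linked-at : ∀ {R : A → A → Set} {xs k} → Linked R (xs ++ [ d ]) → k < length xs →
              R (at d xs k) (at d xs (suc k))
  Linked-at {xs = _ ∷ []}    {zero}  (r ∷ _) _        = r
  Linked-at {xs = _ ∷ []}    {suc k} _       (s≤s ())
  Linked-at {xs = _ ∷ _ ∷ _} {zero}  (r ∷ _) _        = r
  Linked-at {xs = _ ∷ _ ∷ _} {suc k} (_ ∷ l) (s≤s k<) = Linked-at l k<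

NoReturn : ∀ {A : Set} → List A → Set
NoReturn (a ∷ b ∷ c ∷ t) = a ≢ c × NoReturn (b ∷ c ∷ t)
NoReturn _               = ⊤

NoReturn-snoc : ∀ {A : Set} {z : A} ys → Unique ys → z ∉ ys → NoReturn (ys ++ [ z ])
NoReturn-snoc []              _        _  = tt
NoReturn-snoc (_ ∷ [])        _        _  = tt
NoReturn-snoc (_ ∷ _ ∷ [])    _        z∉ = (λ a≡z → z∉ (here (sym a≡z))) , tt
NoReturn-snoc (_ ∷ b ∷ c ∷ t) (a∉ ∷ u) z∉ =
  All.lookup a∉ (there (here refl)) , NoReturn-snoc (b ∷ c ∷ t) u (λ z∈ → z∉ (there z∈))

NoReturn-cycle : ∀ {A : Set} {x : A} {xs} → Unique (x ∷ xs) → 2 ≤ length xs → NoReturn (x ∷ xs ++ [ x ])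
NoReturn-cycle {xs = _ ∷ []}    _        (s≤s ())
NoReturn-cycle {xs = _ ∷ _ ∷ _} (x∉ ∷ u) _ =
  All.lookup x∉ (there (here refl)) , NoReturn-snoc _ u (All¬⇒¬Any x∉)

module _ {A : Set} {f g : A → A} (g∘f≡id : ∀ a → g (f a) ≡ a) where

  -- a g-step right after an f-step would return to the previous element
  forward : ∀ {x y} zs → Linked (λ a b → b ≡ f a ⊎ b ≡ g a) (x ∷ y ∷ zs) → NoReturn (x ∷ y ∷ zs) →
            y ≡ f x → Linked (λ a b → b ≡ f a) (x ∷ y ∷ zs)
  forward     []       _           _          y≡fx = y≡fx ∷ [-]
  forward {x} (z ∷ zs) (_ ∷ steps) (x≢z , nr) y≡fx with Linked.head steps
  ... | inj₁ z≡fy = y≡fx ∷ forward zs steps nr z≡fy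
  ... | inj₂ z≡gy = contradiction (sym (trans z≡gy (trans (cong g y≡fx) (g∘f≡id x)))) x≢z

Linked-iterate : ∀ {A : Set} {f : A → A} {x y} ys → Linked (λ a b → b ≡ f a) (x ∷ ys ++ [ y ]) →
                 y ≡ iterate f x (suc (length ys))
Linked-iterate         []       (y≡fx ∷ [-])   = y≡fx
Linked-iterate {f = f} (z ∷ ys) (z≡fx ∷ chain) =
  trans (Linked-iterate ys chain) (cong (λ w → iterate f w (suc (length ys))) z≡fx)

module _ {N : ℕ} .{{_ : NonZero N}} where

  %-congʳ-+ : ∀ k {i j} → i % N ≡ j % N → (k + i) % N ≡ (k + j) % N
  %-congʳ-+ k {i} {j} i≡j = begin
    (k + i) % N             ≡⟨ %-distribˡ-+ k i N ⟩
    (k % N + i % N) % N     ≡⟨ cong (λ t → (k % N + t) % N) i≡j ⟩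
    (k % N + j % N) % N     ≡⟨ %-distribˡ-+ k j N ⟨
    (k + j) % N             ∎
    where open ≡-Reasoning

  [m+n]%o≡n⇒o∣m : ∀ m n → (m + n) % N ≡ n → N ∣ m
  [m+n]%o≡n⇒o∣m m n eq = divides ((m + n) / N) (+-cancelʳ-≡ n m _ (begin
    m + n                            ≡⟨ m≡m%n+[m/n]*n (m + n) N ⟩
    (m + n) % N + (m + n) / N * N    ≡⟨ cong (_+ (m + n) / N * N) eq ⟩
    n + (m + n) / N * N              ≡⟨ +-comm n _ ⟩
    (m + n) / N * N + n              ∎))
    where open ≡-Reasoning

geomSum : ℕ → ℕ → ℕ
geomSum q zero    = 0
geomSum q (suc k) = suc (q * geomSum q k)

module _ (q : ℕ) where

  geomSum≡sum : ∀ k → geomSum q k ≡ sum (map (q ^_) (upTo k))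
  geomSum≡sum zero    = refl
  geomSum≡sum (suc k) = cong suc (trans (cong (q *_) (geomSum≡sum k)) (scale id k))
    where
    scale : ∀ f k → q * sum (map (q ^_) (applyUpTo f k)) ≡ sum (map (q ^_) (applyUpTo (suc ∘ f) k))
    scale f zero    = *-zeroʳ q
    scale f (suc k) = trans (*-distribˡ-+ q (q ^ f 0) _) (cong (q ^ suc (f 0) +_) (scale (f ∘ suc) k))

  k≤geomSum : 1 ≤ q → ∀ k → k ≤ geomSum q k
  k≤geomSum 1≤q zero    = z≤n
  k≤geomSum 1≤q (suc k) = s≤s (≤-trans (k≤geomSum 1≤q k) (m≤n*m (geomSum q k) q {{>-nonZero 1≤q}}))

  k<geomSum : 2 ≤ q → ∀ k → 2 ≤ k → k < geomSum q k
  k<geomSum 2≤q (suc zero)    (s≤s ())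
  k<geomSum 2≤q (suc (suc j)) _ = s≤s (begin
    suc (suc j)                 ≤⟨ s≤s (m≤n+m (suc j) j) ⟩
    suc j + suc j               ≡⟨ cong (suc j +_) (+-identityʳ (suc j)) ⟨
    2 * suc j                   ≤⟨ *-mono-≤ 2≤q (k≤geomSum (≤-trans (s≤s z≤n) 2≤q) (suc j)) ⟩
    q * geomSum q (suc j)       ∎)
    where open ≤-Reasoning

-- Non-backtracking walks and short cycles

Cycle-map : ∀ {n} {R S : Fin n → Fin n → Set} → (∀ {u v} → R u v → S u v) → Cycle R → Cycle S
Cycle-map R⇒S c = record
  { start    = start c
  ; rest     = rest c
  ; long     = long c
  ; distinct = distinct c
  ; closed   = Linked.map R⇒S (closed c)
  }

module Walks {n : ℕ} (G : SimpleGraph n) where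

  E : Fin n → Fin n → Set
  E = Edge G

  edge-sym : ∀ {x y} → E x y → E y x
  edge-sym {x} {y} e = trans (SimpleGraph.sym G y x) e

  edge⇒≢ : ∀ {x y} → E x y → x ≢ y
  edge⇒≢ {x} e refl with trans (sym e) (irrefl G x)
  ... | ()

  -- NBWalk p x z ws: a walk x ∷ ws from x to z that never immediately
  -- returns to the vertex it came from, and whose first step avoids p.
  data NBWalk : Fin n → Fin n → Fin n → List (Fin n) → Set where
    []   : ∀ {p x} → NBWalk p x x []
    step : ∀ {p x y z ws} → E x y → y ≢ p → NBWalk x y z ws → NBWalk p x z (y ∷ ws)

  NBWalk⇒Linked : ∀ {p x z ws} → NBWalk p x z ws → Linked E (x ∷ ws)
  NBWalk⇒Linked []           = [-]
  NBWalk⇒Linked (step e _ w) = e ∷ NBWalk⇒Linked w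

  prepend : ∀ {x y z ws} → E x y → NBWalk x y z ws → NBWalk x x z (y ∷ ws)
  prepend e w = step e (λ y≡x → edge⇒≢ e (sym y≡x)) w

  unrestricted : ∀ {p x z ws} → NBWalk p x z ws → NBWalk x x z ws
  unrestricted []           = []
  unrestricted (step e _ w) = prepend e w

  avoiding : ∀ {p q x y z ws} → NBWalk p x z (y ∷ ws) → y ≢ q → NBWalk q x z (y ∷ ws)
  avoiding (step e _ w) y≢q = step e y≢q w

  end-∈ : ∀ {p x y z ws} → NBWalk p x z (y ∷ ws) → z ∈ y ∷ ws
  end-∈ (step _ _ [])               = here refl
  end-∈ (step _ _ w@(step _ _ _)) = there (end-∈ w)

  Cycle≤ : ℕ → Set
  Cycle≤ m = Σ (Cycle E) λ c → cycleLength c ≤ m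

  Cycle≤-mono : ∀ {m m′} → m ≤ m′ → Cycle≤ m → Cycle≤ m′
  Cycle≤-mono m≤m′ (c , c≤m) = c , ≤-trans c≤m m≤m′

  no-short-cycle : ∀ {g} → (∀ (c : Cycle E) → g ≤ cycleLength c) → ∀ {m} → m < g → ¬ Cycle≤ m
  no-short-cycle girth≥ m<g (c , c≤m) = <⇒≱ m<g (≤-trans (girth≥ c) c≤m)

  first-return : ∀ {x y z ws} → E x y → NBWalk x y z ws → Unique (y ∷ ws) → x ∈ y ∷ ws →
                 Cycle≤ (length (y ∷ ws))
  first-return {x} {y} {ws = ws} e w u x∈ with ∈-∃++ x∈
  ... | as , bs , eq = cycle , length≤
    where
    long-enough : ∀ as {bs ws z} → y ∷ ws ≡ as ++ x ∷ bs → NBWalk x y z ws → 2 ≤ length as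
    long-enough []          refl _               = contradiction refl (edge⇒≢ e)
    long-enough (_ ∷ [])    refl (step _ x≢x _) = contradiction refl x≢x
    long-enough (_ ∷ _ ∷ _) _    _               = s≤s (s≤s z≤n)
    cycle : Cycle E
    cycle = record
      { start    = x
      ; rest     = as
      ; long     = long-enough as eq w
      ; distinct = Unique-middle as (subst Unique eq u)
      ; closed   = Linked-prefix as (subst (λ l → Linked E (x ∷ l)) eq (e ∷ NBWalk⇒Linked w))
      }
    length≤ : suc (length as) ≤ length (y ∷ ws)
    length≤ = subst (suc (length as) ≤_) (cong length (sym eq))
                (subst (suc (length as) ≤_) (sym (length-++-sucʳ as x bs)) (s≤s (length-++-≤ˡ as)))

  path-or-cycle : ∀ {p x z ws} → NBWalk p x z ws → Unique (x ∷ ws) ⊎ Cycle≤ (length ws)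
  path-or-cycle [] = inj₁ ([] ∷ [])
  path-or-cycle (step {x = x} {y} {ws = ws} e _ w) with path-or-cycle w
  ... | inj₂ c = inj₂ (Cycle≤-mono (n≤1+n _) c)
  ... | inj₁ u with DecMembership._∈?_ _≟ᶠ_ x (y ∷ ws)
  ...   | no  x∉ = inj₁ (¬Any⇒All¬ _ x∉ ∷ u)
  ...   | yes x∈ = inj₂ (first-return e w u x∈)

  closed-walk-cycle : ∀ {p x ws} → NBWalk p x x ws → 0 < length ws → Cycle≤ (length ws)
  closed-walk-cycle {ws = _ ∷ _} w _ with path-or-cycle w
  ... | inj₁ (x∉ ∷ _) = contradiction (end-∈ w) (All¬⇒¬Any x∉)
  ... | inj₂ c        = c

  -- revOnto x ws vs: the reversal of x ∷ ws without its first vertex, followed by vs.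
  revOnto : Fin n → List (Fin n) → List (Fin n) → List (Fin n)
  revOnto x []       vs = vs
  revOnto x (y ∷ ws) vs = revOnto y ws (x ∷ vs)

  length-revOnto : ∀ x ws vs → length (revOnto x ws vs) ≡ length ws + length vs
  length-revOnto x []       vs = refl
  length-revOnto x (y ∷ ws) vs = trans (length-revOnto y ws (x ∷ vs)) (+-suc (length ws) (length vs))

  revOnto-++ : ∀ x ws vs us → revOnto x ws (vs ++ us) ≡ revOnto x ws vs ++ us
  revOnto-++ x []       vs us = refl
  revOnto-++ x (y ∷ ws) vs us = revOnto-++ y ws (x ∷ vs) us

  firstStep : Fin n → List (Fin n) → Fin n
  firstStep x []      = x
  firstStep x (y ∷ _) = y

  reverse-append : ∀ {p x z w ws vs} → NBWalk p x z ws → NBWalk (firstStep x ws) x w vs →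
                   NBWalk z z w (revOnto x ws vs)
  reverse-append []                    v = unrestricted v
  reverse-append (step {x = x} {y} {ws = ws} e _ w) v =
    reverse-append w (step (edge-sym e) (back-step ws w) v)
    where
    back-step : ∀ {z} ws → NBWalk x y z ws → x ≢ firstStep y ws
    back-step []      _                = edge⇒≢ e
    back-step (_ ∷ _) (step _ u≢x _) = λ x≡u → u≢x (sym x≡u)

  distinct-walks⇒cycle : ∀ {p x z ws vs} → NBWalk p x z ws → NBWalk p x z vs → ws ≢ vs →
                         Cycle≤ (length ws + length vs)
  distinct-walks⇒cycle [] [] ws≢vs = contradiction refl ws≢vs
  distinct-walks⇒cycle [] v@(step _ _ _) _ = closed-walk-cycle v (s≤s z≤n)
  distinct-walks⇒cycle {ws = ws} w@(step _ _ _) [] _ =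
    Cycle≤-mono (≤-reflexive (sym (+-identityʳ (length ws)))) (closed-walk-cycle w (s≤s z≤n))
  distinct-walks⇒cycle {x = x} w@(step {y = y} {ws = ws} _ _ w′) v@(step {y = y′} {ws = vs} _ _ v′) ws≢vs
    with y ≟ᶠ y′
  ... | yes refl = Cycle≤-mono (+-mono-≤ (n≤1+n _) (n≤1+n _))
                     (distinct-walks⇒cycle w′ v′ (λ eq → ws≢vs (cong (y ∷_) eq)))
  ... | no  y≢y′ = Cycle≤-mono (≤-reflexive (length-revOnto x (y ∷ ws) (y′ ∷ vs)))
                     (closed-walk-cycle (reverse-append w (avoiding v (λ y′≡y → y≢y′ (sym y′≡y))))
                       (subst (0 <_) (sym (length-revOnto x (y ∷ ws) (y′ ∷ vs))) (s≤s z≤n)))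

  NBWalk-init : ∀ {p x y} as {b} → NBWalk p x y (as ++ [ b ]) → ∃ λ y′ → NBWalk p x y′ as
  NBWalk-init []       _            = _ , []
  NBWalk-init (_ ∷ as) (step e a≢p w) = let y′ , w′ = NBWalk-init as w in y′ , step e a≢p w′

  closed-path : ∀ {p z} xs → NBWalk p z z (xs ++ [ z ]) → Unique (z ∷ xs) → 2 ≤ length xs → Cycle E
  closed-path {z = z} xs w u long = record
    { start = z ; rest = xs ; long = long ; distinct = u ; closed = NBWalk⇒Linked w }

-- Branches in a graph attaining the Moore bound

module Branches {n : ℕ} (G : SimpleGraph n) where
  open Walks G

  E? : ∀ x y → Dec (E x y)
  E? x y = map′ (Equivalence.to T-≡) (Equivalence.from T-≡) (T? (adj G x y))

  children : Fin n → Fin n → List (Fin n)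
  children x p = filter (λ y → E? x y ×-dec ¬? (y ≟ᶠ p)) (allFin n)

  ∈-children : ∀ {x p y} → y ∈ children x p → E x y × y ≢ p
  ∈-children {x} {p} y∈ = proj₂ (∈-filter⁻ (λ y → E? x y ×-dec ¬? (y ≟ᶠ p)) {xs = allFin n} y∈)

  -- the vertices reached from x by non-backtracking walks of length < k whose first step avoids p
  branch : ℕ → Fin n → Fin n → List (Fin n)
  branch zero    x p = []
  branch (suc k) x p = x ∷ concatMap (λ y → branch k y x) (children x p)

  branch-walk : ∀ k {x p z} → z ∈ branch k x p → ∃ λ ws → NBWalk p x z ws × length ws < k
  branch-walk (suc k) (here refl) = [] , [] , s≤s z≤n
  branch-walk (suc k) {x} {p} (there z∈) =
    let y , y∈ , z∈branch = find (∈-concatMap⁻ (λ y → branch k y x) {xs = children x p} z∈)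
        e , y≢p = ∈-children y∈
        ws , w , ws<k = branch-walk k z∈branch
    in y ∷ ws , step e y≢p w , s≤s ws<k

  module _ {r : ℕ} (regular : Regular r G) where

    length-children : ∀ {x p} → E x p → length (children x p) ≡ r ∸ 1
    length-children {x} {p} e =
      trans (sym (m+n∸n≡m _ 1)) (cong (_∸ 1) (begin
        length (children x p) + 1
          ≡⟨ cong₂ _+_ (length-filter≡count _ (allFin n)) (sym (count-≟ (allFin⁺ n) (∈-allFin p))) ⟩
        count (λ y → adj G x y ∧ not (does (y ≟ᶠ p))) (allFin n) + count (λ y → does (y ≟ᶠ p)) (allFin n)
          ≡⟨ count-∧-not p-adjacent (allFin n) ⟩
        degree (adj G) x
          ≡⟨ regular x ⟩
        r ∎))
      where
      open ≡-Reasoning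
      p-adjacent : ∀ y → does (y ≟ᶠ p) ≡ true → adj G x y ≡ true
      p-adjacent y _ with y ≟ᶠ p
      ... | yes refl = e

    branch-length : ∀ k {x p} → E x p → length (branch k x p) ≡ geomSum (r ∸ 1) k
    branch-length zero    _ = refl
    branch-length (suc k) {x} {p} e = cong suc (trans
      (length-concatMap-const (λ y → branch k y x) (children x p)
        (λ y∈ → branch-length k (edge-sym (proj₁ (∈-children y∈)))))
      (cong (_* geomSum (r ∸ 1) k) (length-children e)))

  module _ {g : ℕ} (girth≥ : ∀ (c : Cycle E) → g ≤ cycleLength c) where

    branch-unique : ∀ k {x p} → k + k ≤ g → Unique (branch k x p)
    branch-unique zero    _ = []
    branch-unique (suc k) {x} {p} 2k+2≤g =
      ¬Any⇒All¬ _ x∉subtrees ∷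
      Unique-concatMap⁺ (filter⁺ _ (allFin⁺ n)) (λ _ → branch-unique k (<⇒≤ k+k<g)) subtrees-disjoint
      where
      k+k<g : k + k < g
      k+k<g = ≤-trans (s≤s (+-monoʳ-≤ k (n≤1+n k))) 2k+2≤g
      k<g : k < g
      k<g = ≤-trans (s≤s (m≤m+n k k)) k+k<g
      x∉subtrees : x ∉ concatMap (λ y → branch k y x) (children x p)
      x∉subtrees x∈ =
        let y , y∈ , x∈branch = find (∈-concatMap⁻ (λ y → branch k y x) {xs = children x p} x∈)
            ws , w , ws<k = branch-walk k x∈branch
        in no-short-cycle girth≥ k<g
             (Cycle≤-mono ws<k (closed-walk-cycle (prepend (proj₁ (∈-children y∈)) w) (s≤s z≤n)))
      subtrees-disjoint : ∀ {y y′ z} → y ∈ children x p → y′ ∈ children x p → y ≢ y′ →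
                          z ∈ branch k y x → z ∉ branch k y′ x
      subtrees-disjoint y∈ y′∈ y≢y′ z∈ z∈′ =
        let ws , w , ws<k = branch-walk k z∈
            vs , v , vs<k = branch-walk k z∈′
        in no-short-cycle girth≥ (≤-trans (s≤s (+-mono-≤ ws<k vs<k)) k+k<g)
             (distinct-walks⇒cycle (prepend (proj₁ (∈-children y∈)) w)
                                   (prepend (proj₁ (∈-children y′∈)) v)
                                   (λ eq → y≢y′ (∷-injectiveˡ eq)))

    branches-unique : ∀ k {a b} → E a b → k + k ≤ g → Unique (branch k a b ++ branch k b a)
    branches-unique k {a} {b} e 2k≤g = ++⁺ (branch-unique k 2k≤g) (branch-unique k 2k≤g) sides-disjoint
      where
      not-via : ∀ {z ws} vs → NBWalk b a z ws → ws ≢ b ∷ vs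
      not-via vs (step _ b≢b _) refl = b≢b refl
      sides-disjoint : ∀ {z} → ¬ (z ∈ branch k a b × z ∈ branch k b a)
      sides-disjoint (z∈ , z∈′) =
        let ws , w , ws<k = branch-walk k z∈
            vs , v , vs<k = branch-walk k z∈′
        in no-short-cycle girth≥ (≤-trans (+-mono-≤ ws<k vs<k) 2k≤g)
             (distinct-walks⇒cycle (unrestricted w) (prepend e v) (not-via vs w))

    branches-cover : ∀ {r} → Regular r G → ∀ k {a b} → E a b → k + k ≤ g →
                     geomSum (r ∸ 1) k + geomSum (r ∸ 1) k ≡ n → ∀ z → z ∈ branch k a b ++ branch k b a
    branches-cover {r} regular k {a} {b} e 2k≤g size = Unique∧length≡⇒∈ (branches-unique k e 2k≤g) (begin
      length (branch k a b ++ branch k b a)             ≡⟨ length-++ (branch k a b) ⟩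
      length (branch k a b) + length (branch k b a)     ≡⟨ cong₂ _+_ (branch-length regular k e)
                                                                   (branch-length regular k (edge-sym e)) ⟩
      geomSum (r ∸ 1) k + geomSum (r ∸ 1) k             ≡⟨ size ⟩
      n                                                 ∎)
      where open ≡-Reasoning

-- The cyclic order of a Hamiltonian cycle

module CyclicOrder {n : ℕ} (G : SimpleGraph n) (H : Cycle (Edge G)) (spanning : cycleLength H ≡ n) where
  open Walks G

  N : ℕ
  N = cycleLength H

  vertices : List (Fin n)
  vertices = start H ∷ rest H

  vertex : ℕ → Fin n
  vertex i = at (start H) vertices (i % N)

  position : Fin n → ℕ
  position u = toℕ (index (Unique∧length≡⇒∈ (distinct H) spanning u))

  vertex-position : ∀ u → vertex (position u) ≡ u
  vertex-position u = begin
    at (start H) vertices (toℕ (index u∈H) % N)  ≡⟨ cong (at (start H) vertices)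
                                                          (m<n⇒m%n≡m (toℕ<n (index u∈H))) ⟩
    at (start H) vertices (toℕ (index u∈H))      ≡⟨ at-lookup vertices (index u∈H) ⟩
    lookup vertices (index u∈H)                  ≡⟨ lookup-index u∈H ⟨
    u                                            ∎
    where
    open ≡-Reasoning
    u∈H = Unique∧length≡⇒∈ (distinct H) spanning u

  vertex-injective : ∀ {i j} → vertex i ≡ vertex j → i % N ≡ j % N
  vertex-injective {i} {j} = at-injective (distinct H) (m%n<n i N) (m%n<n j N)

  vertex-cong : ∀ k {i j} → vertex i ≡ vertex j → vertex (k + i) ≡ vertex (k + j)
  vertex-cong k {i} {j} eq = cong (at (start H) vertices) (%-congʳ-+ k (vertex-injective {i} {j} eq))

  vertex-period : ∀ k i → vertex (k + i) ≡ vertex i → 0 < k → N ≤ k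
  vertex-period k i eq 0<k = ∣⇒≤ {{>-nonZero 0<k}} ([m+n]%o≡n⇒o∣m k (i % N) (begin
    (k + i % N) % N  ≡⟨ %-congʳ-+ k (m%n%n≡m%n i N) ⟩
    (k + i) % N      ≡⟨ vertex-injective {k + i} {i} eq ⟩
    i % N            ∎))
    where open ≡-Reasoning

  3≤N : 3 ≤ N
  3≤N = s≤s (long H)

  vertex-nonbacktracking : ∀ i → vertex (2 + i) ≢ vertex i
  vertex-nonbacktracking i eq = <⇒≱ 3≤N (vertex-period 2 i eq (s≤s z≤n))

  vertex-edge : ∀ i → E (vertex i) (vertex (suc i))
  vertex-edge i = subst (E (vertex i)) (trans (wrap (m%n<n i N)) (vertex-cong 1 (vertex-mod i)))
                    (Linked-at (closed H) (m%n<n i N))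
    where
    -- at index N, just past the end of the list, `at` returns the start of H
    wrap : ∀ {k} → k < N → at (start H) vertices (suc k) ≡ vertex (suc k)
    wrap {k} k<N with m≤n⇒m<n∨m≡n k<N
    ... | inj₁ k+1<N = cong (at (start H) vertices) (sym (m<n⇒m%n≡m k+1<N))
    ... | inj₂ refl  = trans (at-length vertices) (cong (at (start H) vertices) (sym (n%n≡0 N)))
    vertex-mod : ∀ i → vertex (i % N) ≡ vertex i
    vertex-mod i = cong (at (start H) vertices) (m%n%n≡m%n i N)

  vertex-N+ : ∀ i → vertex (N + i) ≡ vertex i
  vertex-N+ i = cong (at (start H) vertices) (%-remove-+ˡ i (∣-refl {N}))

  next prev : Fin n → Fin n
  next u = vertex (1 + position u)
  prev u = vertex (length (rest H) + position u)

  next-vertex : ∀ i → next (vertex i) ≡ vertex (suc i)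
  next-vertex i = vertex-cong 1 (vertex-position (vertex i))

  next-prev : ∀ u → next (prev u) ≡ u
  next-prev u = begin
    vertex (1 + position (prev u))                   ≡⟨ vertex-cong 1 (vertex-position (prev u)) ⟩
    vertex (N + position u)                          ≡⟨ vertex-N+ (position u) ⟩
    vertex (position u)                              ≡⟨ vertex-position u ⟩
    u                                                ∎
    where open ≡-Reasoning

  prev-next : ∀ u → prev (next u) ≡ u
  prev-next u = begin
    vertex (length (rest H) + position (next u))     ≡⟨ vertex-cong (length (rest H)) (vertex-position (next u)) ⟩
    vertex (length (rest H) + suc (position u))      ≡⟨ cong vertex (+-suc (length (rest H)) (position u)) ⟩
    vertex (N + position u)                          ≡⟨ vertex-N+ (position u) ⟩
    vertex (position u)                              ≡⟨ vertex-position u ⟩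
    u                                                ∎
    where open ≡-Reasoning

  edge-next : ∀ u → E u (next u)
  edge-next u = subst (λ v → E v (next u)) (vertex-position u) (vertex-edge (position u))

  edge-prev : ∀ u → E u (prev u)
  edge-prev u = edge-sym (subst (E (prev u)) (next-prev u) (edge-next (prev u)))

  iterate-next : ∀ k i → iterate next (vertex i) k ≡ vertex (k + i)
  iterate-next zero    i = refl
  iterate-next (suc k) i = begin
    iterate next (next (vertex i)) k   ≡⟨ cong (λ u → iterate next u k) (next-vertex i) ⟩
    iterate next (vertex (suc i)) k    ≡⟨ iterate-next k (suc i) ⟩
    vertex (k + suc i)                 ≡⟨ cong vertex (+-suc k i) ⟩
    vertex (suc k + i)                 ∎
    where open ≡-Reasoning

  next-period : ∀ {u k} → iterate next u k ≡ u → 0 < k → N ≤ k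
  next-period {u} {k} eq = vertex-period k (position u) (begin
    vertex (k + position u)                ≡⟨ iterate-next k (position u) ⟨
    iterate next (vertex (position u)) k   ≡⟨ cong (λ v → iterate next v k) (vertex-position u) ⟩
    iterate next u k                       ≡⟨ eq ⟩
    u                                      ≡⟨ vertex-position u ⟨
    vertex (position u)                    ∎)
    where open ≡-Reasoning

  prev-period : ∀ {u k} → iterate prev u k ≡ u → 0 < k → N ≤ k
  prev-period {u} {k} eq =
    next-period (trans (cong (λ v → iterate next v k) (sym eq)) (iterate-inverse next-prev k u))

  next≢prev : ∀ u → next u ≢ prev u
  next≢prev u eq = <⇒≱ 3≤N (next-period {u} {2} (trans (cong next eq) (next-prev u)) (s≤s z≤n))

  segment : ℕ → ℕ → List (Fin n)
  segment i zero    = []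
  segment i (suc k) = vertex (suc i) ∷ segment (suc i) k

  length-segment : ∀ i k → length (segment i k) ≡ k
  length-segment i zero    = refl
  length-segment i (suc k) = cong suc (length-segment (suc i) k)

  segment-suc : ∀ i k → segment i (suc k) ≡ segment i k ++ [ vertex (i + suc k) ]
  segment-suc i zero    = cong (λ j → [ vertex j ]) (+-comm 1 i)
  segment-suc i (suc k) = cong (vertex (suc i) ∷_) (trans (segment-suc (suc i) k)
    (cong (λ j → segment (suc i) k ++ [ vertex j ]) (sym (+-suc i (suc k)))))

  segment-walk : ∀ i k {q} → (0 < k → vertex (suc i) ≢ q) →
                 NBWalk q (vertex i) (vertex (i + k)) (segment i k)
  segment-walk i zero {q} _ = subst (λ j → NBWalk q (vertex i) (vertex j) []) (sym (+-identityʳ i)) []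
  segment-walk i (suc k) avoid =
    step (vertex-edge i) (avoid (s≤s z≤n))
      (subst (λ j → NBWalk (vertex i) (vertex (suc i)) (vertex j) (segment (suc i) k)) (sym (+-suc i k))
        (segment-walk (suc i) k (λ _ → vertex-nonbacktracking i)))

-- Existence of the girth of a wgraph

module WGirth {n : ℕ} (W : WGraph n) where

  CycleOfWeight : ℕ → Set
  CycleOfWeight w = Σ (Cycle (WEdge W)) λ c → cycleWeight W c ≡ w

  cycleOfWeight? : ∀ w → Dec (CycleOfWeight w)
  cycleOfWeight? w = map′ toCycle fromCycle (any?ᶠ λ s → ∃-list? (cycle? s) n)
    where
    IsCycle : Fin n → List (Fin n) → Set
    IsCycle s rs = 2 ≤ length rs × Unique (s ∷ rs) × Linked (WEdge W) (s ∷ rs ++ [ s ]) ×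
                   walkWeight W (s ∷ rs ++ [ s ]) ≡ w
    wedge? : ∀ u v → Dec (WEdge W u v)
    wedge? u v = (adj (light W) u v ≟ᵇ true) ⊎-dec (adj (heavy W) u v ≟ᵇ true)
    cycle? : ∀ s rs → Dec (IsCycle s rs)
    cycle? s rs = (2 ≤? length rs) ×-dec unique? _≟ᶠ_ (s ∷ rs) ×-dec
                  linked? wedge? (s ∷ rs ++ [ s ]) ×-dec (walkWeight W (s ∷ rs ++ [ s ]) ≟ w)
    toCycle : (∃ λ s → ∃ λ rs → length rs ≤ n × IsCycle s rs) → CycleOfWeight w
    toCycle (s , rs , _ , long , u , closed , eq) =
      record { start = s ; rest = rs ; long = long ; distinct = u ; closed = closed } , eq
    fromCycle : CycleOfWeight w → ∃ λ s → ∃ λ rs → length rs ≤ n × IsCycle s rs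
    fromCycle (c , eq) = start c , rest c , ≤-trans (n≤1+n _) (Unique⇒length≤ (distinct c)) ,
                         long c , distinct c , closed c , eq

  girth-exists : ∀ (c₀ : Cycle (WEdge W)) → ∃ λ g → HasWGirth W g × g ≤ cycleWeight W c₀
  girth-exists c₀ =
    let g , cycle-g , minimal = least cycleOfWeight? (c₀ , refl)
    in g , (cycle-g , λ c → minimal (c , refl)) , minimal (c₀ , refl)

-- The wgraph of a Hamiltonian cycle

module HamiltonianWGraph {n : ℕ} (G : SimpleGraph n) (H : Cycle (Edge G)) (spanning : cycleLength H ≡ n) where
  open Walks G
  open CyclicOrder G H spanning

  Consecutive : Fin n → Fin n → Set
  Consecutive u v = v ≡ next u ⊎ v ≡ prev u

  consecutive? : ∀ u v → Dec (Consecutive u v)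
  consecutive? u v = (v ≟ᶠ next u) ⊎-dec (v ≟ᶠ prev u)

  Consecutive-sym : ∀ {u v} → Consecutive u v → Consecutive v u
  Consecutive-sym {u} (inj₁ refl) = inj₂ (sym (prev-next u))
  Consecutive-sym {u} (inj₂ refl) = inj₁ (sym (next-prev u))

  Consecutive⇒Edge : ∀ {u v} → Consecutive u v → E u v
  Consecutive⇒Edge {u} (inj₁ refl) = edge-next u
  Consecutive⇒Edge {u} (inj₂ refl) = edge-prev u

  lightAdj : Fin n → Fin n → Bool
  lightAdj u v = does (consecutive? u v)

  heavyAdj : Fin n → Fin n → Bool
  heavyAdj u v = adj G u v ∧ not (lightAdj u v)

  Light : Fin n → Fin n → Set
  Light u v = lightAdj u v ≡ true

  Light⇒Consecutive : ∀ {u v} → Light u v → Consecutive u v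
  Light⇒Consecutive = does-true⇒ (consecutive? _ _)

  Consecutive⇒Light : ∀ {u v} → Consecutive u v → Light u v
  Consecutive⇒Light = dec-true (consecutive? _ _)

  lightG : SimpleGraph n
  lightG = record
    { adj    = lightAdj
    ; sym    = λ u v → does-⇔ (mk⇔ Consecutive-sym Consecutive-sym) (consecutive? u v) (consecutive? v u)
    ; irrefl = λ v → dec-false (consecutive? v v) (λ c → edge⇒≢ (Consecutive⇒Edge c) refl)
    }

  heavyG : SimpleGraph n
  heavyG = record
    { adj    = heavyAdj
    ; sym    = λ u v → cong₂ (λ a b → a ∧ not b) (SimpleGraph.sym G u v) (SimpleGraph.sym lightG u v)
    ; irrefl = λ v → cong (_∧ not (lightAdj v v)) (irrefl G v)
    }

  W : WGraph n
  W = record { light = lightG ; heavy = heavyG ; disjoint = light-heavy-disjoint }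
    where
    light-heavy-disjoint : ∀ u v → ¬ (Light u v × heavyAdj u v ≡ true)
    light-heavy-disjoint u v (l , h) with trans (sym h) (trans (cong (λ b → adj G u v ∧ not b) l) (∧-zeroʳ _))
    ... | ()

  WEdge⇒Edge : ∀ {u v} → WEdge W u v → E u v
  WEdge⇒Edge (inj₁ l) = Consecutive⇒Edge (Light⇒Consecutive l)
  WEdge⇒Edge {u} {v} (inj₂ h) with adj G u v
  ... | true = refl

  Edge⇒WEdge : ∀ {u v} → E u v → WEdge W u v
  Edge⇒WEdge {u} {v} e with lightAdj u v in l
  ... | true  = inj₁ refl
  ... | false = inj₂ (cong (_∧ true) e)

  light-regular : Regular 2 lightG
  light-regular u = begin
    count (λ w → does (w ≟ᶠ next u) ∨ does (w ≟ᶠ prev u)) (allFin n)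
      ≡⟨ count-∨ distinct-nbrs (allFin n) ⟩
    count (λ w → does (w ≟ᶠ next u)) (allFin n) + count (λ w → does (w ≟ᶠ prev u)) (allFin n)
      ≡⟨ cong₂ _+_ (count-≟ (allFin⁺ n) (∈-allFin _)) (count-≟ (allFin⁺ n) (∈-allFin _)) ⟩
    2 ∎
    where
    open ≡-Reasoning
    distinct-nbrs : ∀ w → does (w ≟ᶠ next u) ∧ does (w ≟ᶠ prev u) ≡ false
    distinct-nbrs w with w ≟ᶠ next u | w ≟ᶠ prev u
    ... | yes refl | yes w≡prev = contradiction w≡prev (next≢prev u)
    ... | yes _    | no  _      = refl
    ... | no  _    | _          = refl

  heavy-regular : ∀ {r} → Regular r G → Regular (r ∸ 2) heavyG
  heavy-regular {r} regular u = trans (sym (m+n∸n≡m _ 2)) (cong (_∸ 2) (begin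
    degree heavyAdj u + 2                        ≡⟨ cong (degree heavyAdj u +_) (light-regular u) ⟨
    degree heavyAdj u + degree lightAdj u        ≡⟨ count-∧-not (λ w l → WEdge⇒Edge (inj₁ l)) (allFin n) ⟩
    degree (adj G) u                             ≡⟨ regular u ⟩
    r                                            ∎))
    where open ≡-Reasoning

  length≤walkWeight : ∀ x xs → length xs ≤ walkWeight W (x ∷ xs)
  length≤walkWeight x []       = z≤n
  length≤walkWeight x (y ∷ ys) with lightAdj x y
  ... | true  = s≤s (length≤walkWeight y ys)
  ... | false = s≤s (m≤n⇒m≤1+n (length≤walkWeight y ys))

  all-light-or-heavier : ∀ x xs → Linked Light (x ∷ xs) ⊎ suc (length xs) ≤ walkWeight W (x ∷ xs)
  all-light-or-heavier x []       = inj₁ [-]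
  all-light-or-heavier x (y ∷ ys) with lightAdj x y in l | all-light-or-heavier y ys
  ... | true  | inj₁ light   = inj₁ (l ∷ light)
  ... | true  | inj₂ heavier = inj₂ (s≤s heavier)
  ... | false | _            = inj₂ (s≤s (s≤s (length≤walkWeight y ys)))

  all-light⇒spanning : ∀ {x xs} → Unique (x ∷ xs) → 2 ≤ length xs → Linked Light (x ∷ xs ++ [ x ]) →
                       N ≤ suc (length xs)
  all-light⇒spanning {x} {y ∷ zs} u long light = along (Light⇒Consecutive (Linked.head light))
    where
    steps : Linked Consecutive (x ∷ y ∷ zs ++ [ x ])
    steps = Linked.map Light⇒Consecutive light
    along : Consecutive x y → N ≤ suc (length (y ∷ zs))
    along (inj₁ y≡next) = next-period (sym (Linked-iterate (y ∷ zs)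
      (forward prev-next (zs ++ [ x ]) steps (NoReturn-cycle u long) y≡next))) (s≤s z≤n)
    along (inj₂ y≡prev) = prev-period (sym (Linked-iterate (y ∷ zs)
      (forward next-prev (zs ++ [ x ]) (Linked.map swap steps) (NoReturn-cycle u long) y≡prev))) (s≤s z≤n)

  girth-lower-bound : ∀ {g} → (∀ (c : Cycle E) → g ≤ cycleLength c) → g < N →
                      ∀ (c : Cycle (WEdge W)) → suc g ≤ cycleWeight W c
  girth-lower-bound girth≥ g<N c with all-light-or-heavier (start c) (rest c ++ [ start c ])
  ... | inj₁ light   = ≤-trans g<N (≤-trans (all-light⇒spanning (distinct c) (long c) light)
                         (subst (_≤ cycleWeight W c) (length-snoc (rest c) (start c))
                           (length≤walkWeight (start c) (rest c ++ [ start c ]))))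
  ... | inj₂ heavier = ≤-trans (s≤s (girth≥ (Cycle-map WEdge⇒Edge c)))
                         (subst (λ m → suc m ≤ cycleWeight W c) (length-snoc (rest c) (start c)) heavier)

  edgeWeight≤2 : ∀ x y → edgeWeight W x y ≤ 2
  edgeWeight≤2 x y with lightAdj x y
  ... | true  = s≤s z≤n
  ... | false = ≤-refl

  walkWeight-revOnto : ∀ {p x z ws} → NBWalk p x z ws → ∀ vs →
                       walkWeight W (z ∷ revOnto x ws vs) ≤ length ws + length ws + walkWeight W (x ∷ vs)
  walkWeight-revOnto []                                  vs = ≤-refl
  walkWeight-revOnto {x = x} (step {y = y} {ws = ws} _ _ w) vs = begin
    walkWeight W (_ ∷ revOnto y ws (x ∷ vs))
      ≤⟨ walkWeight-revOnto w (x ∷ vs) ⟩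
    length ws + length ws + (edgeWeight W y x + walkWeight W (x ∷ vs))
      ≤⟨ +-monoʳ-≤ (length ws + length ws) (+-monoˡ-≤ _ (edgeWeight≤2 y x)) ⟩
    length ws + length ws + (2 + walkWeight W (x ∷ vs))
      ≡⟨ regroup (length ws) (walkWeight W (x ∷ vs)) ⟩
    suc (length ws) + suc (length ws) + walkWeight W (x ∷ vs) ∎
    where
    open ≤-Reasoning
    regroup : ∀ k w → k + k + (2 + w) ≡ suc k + suc k + w
    regroup = solve-∀

  walkWeight-segment : ∀ i k → walkWeight W (vertex i ∷ segment i k) ≡ k
  walkWeight-segment i zero    = refl
  walkWeight-segment i (suc k) =
    cong₂ _+_ (cong (λ b → if b then 1 else 2) (Consecutive⇒Light (inj₁ (sym (next-vertex i)))))
              (walkWeight-segment (suc i) k)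

  module _ {D : ℕ} (2≤D : 2 ≤ D) (girth≥ : ∀ (c : Cycle E) → D + D ≤ cycleLength c) where
    open Branches G using (branch; branch-walk)

    far-branch-excluded : vertex (suc D) ∉ branch D (vertex 1) (vertex 0)
    far-branch-excluded z∈ =
      let ws , w , ws<D = branch-walk D z∈
      in no-short-cycle girth≥
           (subst (λ m → length ws + m < D + D) (sym (length-segment 1 D)) (+-monoˡ-< D ws<D))
           (distinct-walks⇒cycle w (segment-walk 1 D (λ _ → vertex-nonbacktracking 0))
             (λ eq → <-irrefl (trans (cong length eq) (length-segment 1 D)) ws<D))

    near-branch-cycle : ∀ {ws} → NBWalk (vertex 1) (vertex 0) (vertex (suc D)) ws → length ws < D →
                        Σ (Cycle (WEdge W)) λ c → cycleWeight W c ≤ 3 * D ∸ 1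
    near-branch-cycle {ws} w ws<D = Cycle-map Edge⇒WEdge cycle , weight≤
      where
      z : Fin n
      z = vertex (suc D)
      xs : List (Fin n)
      xs = revOnto (vertex 0) ws (segment 0 D)
      first-avoids : ∀ {ws y} → NBWalk (vertex 1) (vertex 0) y ws → vertex 1 ≢ firstStep (vertex 0) ws
      first-avoids []              = λ eq → edge⇒≢ (vertex-edge 0) (sym eq)
      first-avoids (step _ u≢v₁ _) = λ eq → u≢v₁ (sym eq)
      xs++z : revOnto (vertex 0) ws (segment 0 (suc D)) ≡ xs ++ [ z ]
      xs++z = trans (cong (revOnto (vertex 0) ws) (segment-suc 0 D))
                    (revOnto-++ (vertex 0) ws (segment 0 D) [ z ])
      closed-walk : NBWalk z z z (xs ++ [ z ])
      closed-walk = subst (NBWalk z z z) xs++z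
                      (reverse-append w (segment-walk 0 (suc D) (λ _ → first-avoids w)))
      length-xs : length xs ≡ length ws + D
      length-xs = trans (length-revOnto (vertex 0) ws (segment 0 D)) (cong (length ws +_) (length-segment 0 D))
      xs<D+D : length xs < D + D
      xs<D+D = subst (_< D + D) (sym length-xs) (+-monoˡ-< D ws<D)
      path : Unique (z ∷ xs)
      path with path-or-cycle (proj₂ (NBWalk-init xs closed-walk))
      ... | inj₁ u = u
      ... | inj₂ c = contradiction c (no-short-cycle girth≥ xs<D+D)
      cycle : Cycle E
      cycle = closed-path xs closed-walk path
                (≤-trans 2≤D (subst (D ≤_) (sym length-xs) (m≤n+m D (length ws))))
      D≡1+ws : D ≡ suc (length ws)
      D≡1+ws = ≤-antisym
        (+-cancelʳ-≤ D D (suc (length ws)) (subst (D + D ≤_) (cong suc length-xs) (girth≥ cycle))) ws<D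
      weight≤ : walkWeight W (z ∷ xs ++ [ z ]) ≤ 3 * D ∸ 1
      weight≤ = begin
        walkWeight W (z ∷ xs ++ [ z ])
          ≡⟨ cong (λ l → walkWeight W (z ∷ l)) xs++z ⟨
        walkWeight W (z ∷ revOnto (vertex 0) ws (segment 0 (suc D)))
          ≤⟨ walkWeight-revOnto w (segment 0 (suc D)) ⟩
        length ws + length ws + walkWeight W (vertex 0 ∷ segment 0 (suc D))
          ≡⟨ cong (length ws + length ws +_) (walkWeight-segment 0 (suc D)) ⟩
        length ws + length ws + suc D
          ≡⟨ cong (λ d → length ws + length ws + suc d) D≡1+ws ⟩
        length ws + length ws + suc (suc (length ws))
          ≡⟨ cong (_∸ 1) (3k+3 (length ws)) ⟩
        3 * suc (length ws) ∸ 1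
          ≡⟨ cong (λ d → 3 * d ∸ 1) D≡1+ws ⟨
        3 * D ∸ 1 ∎
        where
        open ≤-Reasoning
        3k+3 : ∀ k → suc (k + k + suc (suc k)) ≡ 3 * suc k
        3k+3 = solve-∀

    girth-upper-bound : (∀ z → z ∈ branch D (vertex 0) (vertex 1) ++ branch D (vertex 1) (vertex 0)) →
                        Σ (Cycle (WEdge W)) λ c → cycleWeight W c ≤ 3 * D ∸ 1
    girth-upper-bound cover with ∈-++⁻ (branch D (vertex 0) (vertex 1)) (cover (vertex (suc D)))
    ... | inj₁ near = let _ , w , ws<D = branch-walk D near in near-branch-cycle w ws<D
    ... | inj₂ far  = contradiction far far-branch-excluded

    girth-bounds : (∀ z → z ∈ branch D (vertex 0) (vertex 1) ++ branch D (vertex 1) (vertex 0)) →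
                   D + D < N → ∃ λ g → HasWGirth W g × D + D < g × g ≤ 3 * D ∸ 1
    girth-bounds cover D+D<N =
      let c , c≤3D-1 = girth-upper-bound cover
          g , ((c-g , c-g≡g) , minimal) , g≤c = WGirth.girth-exists W c
      in g , ((c-g , c-g≡g) , minimal) , subst (D + D <_) c-g≡g (girth-lower-bound girth≥ D+D<N c-g) ,
         ≤-trans g≤c c≤3D-1

n₀≡geomSum : ∀ r D → n₀ r (D * 2) ≡ geomSum (r ∸ 1) D + geomSum (r ∸ 1) D
n₀≡geomSum r D = begin
  2 * sum (map ((r ∸ 1) ^_) (upTo (D * 2 / 2)))  ≡⟨ cong (λ k → 2 * sum (map ((r ∸ 1) ^_) (upTo k)))
                                                         (m*n/n≡m D 2) ⟩
  2 * sum (map ((r ∸ 1) ^_) (upTo D))            ≡⟨ cong (2 *_) (geomSum≡sum (r ∸ 1) D) ⟨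
  2 * geomSum (r ∸ 1) D                          ≡⟨ cong (geomSum (r ∸ 1) D +_) (+-identityʳ _) ⟩
  geomSum (r ∸ 1) D + geomSum (r ∸ 1) D          ∎
  where open ≡-Reasoning

D*2≡D+D : ∀ D → D * 2 ≡ D + D
D*2≡D+D D = trans (*-comm D 2) (cong (D +_) (+-identityʳ D))

3≤D*2⇒2≤D : ∀ D → 3 ≤ D * 2 → 2 ≤ D
3≤D*2⇒2≤D (suc zero)    (s≤s (s≤s ()))
3≤D*2⇒2≤D (suc (suc D)) _ = s≤s (s≤s z≤n)

theorem19 : (r g′ : ℕ) → 3 ≤ r → 2 ∣ g′ →
    (Σ (SimpleGraph (n₀ r g′)) λ G → Regular r G × HasGirth G g′ × Hamiltonian G) →
    ∃ λ g → g′ + 1 ≤ g × g ≤ 3 * (g′ / 2) ∸ 1 × nABG≤ 2 (r ∸ 2) g (n₀ r g′)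
theorem19 r .(D * 2) 3≤r (divides D refl) (G , regular , ((c₀ , c₀≡g′) , girth≥) , (H , spanning)) =
  conclude (girth-bounds 2≤D girth≥′ cover D+D<N)
  where
  open HamiltonianWGraph G H spanning
  open CyclicOrder G H spanning using (N; vertex; vertex-edge)
  open Branches G using (branch; branches-cover)
  size : geomSum (r ∸ 1) D + geomSum (r ∸ 1) D ≡ n₀ r (D * 2)
  size = sym (n₀≡geomSum r D)
  2≤D : 2 ≤ D
  2≤D = 3≤D*2⇒2≤D D (subst (3 ≤_) c₀≡g′ (s≤s (long c₀)))
  girth≥′ : ∀ c → D + D ≤ cycleLength c
  girth≥′ c = subst (_≤ cycleLength c) (D*2≡D+D D) (girth≥ c)
  D<geomSum : D < geomSum (r ∸ 1) D
  D<geomSum = k<geomSum (r ∸ 1) (∸-monoˡ-≤ 1 3≤r) D 2≤D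
  cover : ∀ z → z ∈ branch D (vertex 0) (vertex 1) ++ branch D (vertex 1) (vertex 0)
  cover = branches-cover girth≥′ regular D (vertex-edge 0) ≤-refl size
  D+D<N : D + D < N
  D+D<N = subst (D + D <_) (trans size (sym spanning)) (+-mono-< D<geomSum D<geomSum)
  conclude : (∃ λ g → HasWGirth W g × D + D < g × g ≤ 3 * D ∸ 1) →
             ∃ λ g → D * 2 + 1 ≤ g × g ≤ 3 * (D * 2 / 2) ∸ 1 × nABG≤ 2 (r ∸ 2) g (n₀ r (D * 2))
  conclude (g , hasGirth , D+D<g , g≤3D-1) =
    g , subst (_≤ g) (trans (cong suc (sym (D*2≡D+D D))) (+-comm 1 (D * 2))) D+D<g ,
    subst (λ d → g ≤ 3 * d ∸ 1) (sym (m*n/n≡m D 2)) g≤3D-1 ,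
    n₀ r (D * 2) , ≤-refl , W , (light-regular , heavy-regular regular) , hasGirth
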